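{- Let $\tau\in\mathrm{Sym}_n(\mathbb{Q})$, $\mathbf{z}\in\mathbb{C}^n$, and write $\tau=AB^{ -1}$ in reduced form. Then: (a) for $\mathbf{y}\in\mathbb{Q}^n$, one has $\mathbf{y}\in\mathbb{Z}^n$ and $\tau\mathbf{y}\in\mathbb{Z}^n$ if and only if $\mathbf{y}\in B\mathbb{Z}^n$; (b) $L_{\mathbf{z},\tau}=\{\mathbf{y}\in B\mathbb{Z}^n:\ f_{\mathbf{z},\tau}(\mathbf{y})\in\mathbb{Z}\}$; (c) $L_{\mathbf{z},\tau}=B\mathbb{Z}^n$ if and only if ${}^tBA+2\,\mathrm{diag}({}^tB\mathbf{z})$ is an even integral matrix.
   Context: $f_{\mathbf{z},\tau}(\mathbf{x})=\frac12{}^t\mathbf{x}\tau\mathbf{x}+{}^t\mathbf{x}\mathbf{z}$. For $(\mathbf{z},\tau)\in\mathbb{C}^n\times\mathrm{Sym}_n(\mathbb{Q})$, $L_{\mathbf{z},\tau}$ is the set of $\mathbf{y}\in\mathbb{Z}^n$ such that $f_{\mathbf{z},\tau}(\mathbf{y})+{}^t\mathbf{x}\tau\mathbf{y}\in\mathbb{Z}$ for all $\mathbf{x}\in\mathbb{Z}^n$. A matrix $\tau\in\mathrm{Sym}_n(\mathbb{Q})$ is written in reduced form $\tau=AB^{ -1}$ if $A=UP$, $B=VQ$ with $U,V\in\mathrm{GL}_n(\mathbb{Z})$, $P=\mathrm{diag}(p_i)$, $Q=\mathrm{diag}(q_i)$, $p_i,q_i\in\mathbb{Z}$, $q_i>0$,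 $\gcd(p_i,q_i)=1$, and $\tau=UPQ^{ -1}V^{ -1}$. $\mathrm{diag}(\mathbf{v})$ is the diagonal matrix with diagonal $\mathbf{v}$; a symmetric matrix is even integral if it has integer entries and even diagonal entries. -}

module Defs where

open import Level using (Level; _⊔_)
open import Data.Nat using (ℕ; zero; suc)
open import Data.Fin using (Fin; zero; suc; _≟_)
open import Data.Bool using (if_then_else_)
open import Data.Integer as ℤ using (ℤ; +_)
open import Data.Integer.Coprimality using (Coprime)
open import Data.Rational as ℚ using (ℚ; ½)
open import Data.Rational.Properties using (+-*-ring)
open import Algebra.Module.Bundles using (LeftModule)
open import Data.Product using (Σ; ∃; _×_)
open import Relation.Binary.PropositionalEquality using (_≡_)
open import Relation.Nullary using (does)

Mat : ∀ {a} → Set a → ℕ → Set a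
Mat A n = Fin n → Fin n → A

Vect : ∀ {a} → Set a → ℕ → Set a
Vect A n = Fin n → A

sumℤ : ∀ {n} → (Fin n → ℤ) → ℤ
sumℤ {zero} f = + 0
sumℤ {suc n} f = f zero ℤ.+ sumℤ (λ i → f (suc i))

_·ℤ_ : ∀ {n} → Mat ℤ n → Mat ℤ n → Mat ℤ n
(M ·ℤ N) i j = sumℤ (λ k → M i k ℤ.* N k j)

_·ℤv_ : ∀ {n} → Mat ℤ n → Vect ℤ n → Vect ℤ n
(M ·ℤv v) i = sumℤ (λ k → M i k ℤ.* v k)

transposeℤ : ∀ {n} → Mat ℤ n → Mat ℤ n
transposeℤ M i j = M j i

idℤ : ∀ {n} → Mat ℤ n
idℤ i j = if does (i ≟ j) then + 1 else + 0

diagℤ : ∀ {n} → Vect ℤ n → Mat ℤ n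
diagℤ v i j = if does (i ≟ j) then v i else + 0

GLℤ : ∀ {n} → Mat ℤ n → Set
GLℤ {n} U = Σ (Mat ℤ n) λ U' →
  (∀ i j → (U ·ℤ U') i j ≡ idℤ i j) × (∀ i j → (U' ·ℤ U) i j ≡ idℤ i j)

toℚ : ℤ → ℚ
toℚ k = k ℚ./ 1

sumℚ : ∀ {n} → (Fin n → ℚ) → ℚ
sumℚ {zero} f = ℚ.0ℚ
sumℚ {suc n} f = f zero ℚ.+ sumℚ (λ i → f (suc i))

_·ℚ_ : ∀ {n} → Mat ℚ n → Mat ℚ n → Mat ℚ n
(M ·ℚ N) i j = sumℚ (λ k → M i k ℚ.* N k j)

_·ℚv_ : ∀ {n} → Mat ℚ n → Vect ℚ n → Vect ℚ n
(M ·ℚv v) i = sumℚ (λ k → M i k ℚ.* v k)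

bilinℚ : ∀ {n} → Vect ℚ n → Mat ℚ n → Vect ℚ n → ℚ
bilinℚ x M y = sumℚ (λ i → x i ℚ.* (M ·ℚv y) i)

castMat : ∀ {n} → Mat ℤ n → Mat ℚ n
castMat M i j = toℚ (M i j)

castVec : ∀ {n} → Vect ℤ n → Vect ℚ n
castVec v i = toℚ (v i)

SymMat : ∀ {n} → Mat ℚ n → Set
SymMat τ = ∀ i j → τ i j ≡ τ j i

IsIntVecℚ : ∀ {n} → Vect ℚ n → Set
IsIntVecℚ y = ∀ i → ∃ λ (k : ℤ) → y i ≡ toℚ k

InBZℚ : ∀ {n} → Mat ℤ n → Vect ℚ n → Set
InBZℚ {n} B y = Σ (Vect ℤ n) λ k → ∀ i → y i ≡ toℚ ((B ·ℤv k) i)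

InBZ : ∀ {n} → Mat ℤ n → Vect ℤ n → Set
InBZ {n} B y = Σ (Vect ℤ n) λ k → ∀ i → y i ≡ (B ·ℤv k) i

-- Reduced form τ = A B⁻¹ :  A = U P, B = V Q, U V ∈ GL_n(ℤ),
-- P = diag(p), Q = diag(q), q_i > 0, gcd(p_i, q_i) = 1,
-- τ = U P Q⁻¹ V⁻¹ (equivalently, as B is invertible over ℚ, τ B = A).

record ReducedForm {n : ℕ} (τ : Mat ℚ n) (A B : Mat ℤ n) : Set where
  field
    U V : Mat ℤ n
    p q : Vect ℤ n
    U-GL : GLℤ U
    V-GL : GLℤ V
    q-pos : ∀ i → + 0 ℤ.< q i
    pq-coprime : ∀ i → Coprime (p i) (q i)
    A≡UP : ∀ i j → A i j ≡ (U ·ℤ diagℤ p) i j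
    B≡VQ : ∀ i j → B i j ≡ (V ·ℤ diagℤ q) i j
    τB≡A : ∀ i j → (τ ·ℚ castMat B) i j ≡ castMat A i j

-- The coefficient space: ℂ is replaced by an arbitrary ℚ-vector space
-- (left module over the ring ℚ) with a distinguished nonzero element e
-- playing the role of 1 ∈ ℂ (so ℚ ⊆ V via q ↦ q e).

module Coeff {m ℓ : Level} (M : LeftModule +-*-ring m ℓ) (e : LeftModule.Carrierᴹ M) where
  open LeftModule M

  ι : ℚ → Carrierᴹ
  ι r = r *ₗ e

  IsInt : Carrierᴹ → Set ℓ
  IsInt v = ∃ λ (k : ℤ) → v ≈ᴹ ι (toℚ k)

  IsEvenInt : Carrierᴹ → Set ℓ
  IsEvenInt v = ∃ λ (k : ℤ) → v ≈ᴹ ι (toℚ (+ 2 ℤ.* k))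

  sumᴹ : ∀ {n} → (Fin n → Carrierᴹ) → Carrierᴹ
  sumᴹ {zero} f = 0ᴹ
  sumᴹ {suc n} f = f zero +ᴹ sumᴹ (λ i → f (suc i))

  dotᴹ : ∀ {n} → Vect ℚ n → Vect Carrierᴹ n → Carrierᴹ
  dotᴹ x z = sumᴹ (λ i → x i *ₗ z i)

  f : ∀ {n} → Vect Carrierᴹ n → Mat ℚ n → Vect ℚ n → Carrierᴹ
  f z τ x = ι (½ ℚ.* bilinℚ x τ x) +ᴹ dotᴹ x z

  InL : ∀ {n} → Vect Carrierᴹ n → Mat ℚ n → Vect ℤ n → Set ℓ
  InL {n} z τ y = (x : Vect ℤ n) →
    IsInt (f z τ (castVec y) +ᴹ ι (bilinℚ (castVec x) τ (castVec y)))

  tBz : ∀ {n} → Mat ℤ n → Vect Carrierᴹ n → Vect Carrierᴹ n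
  tBz B z i = dotᴹ (λ k → toℚ (B k i)) z

  diagᴹ : ∀ {n} → Vect Carrierᴹ n → Mat Carrierᴹ n
  diagᴹ v i j = if does (i ≟ j) then v i else 0ᴹ

  keyMatrix : ∀ {n} → Mat ℤ n → Mat ℤ n → Vect Carrierᴹ n → Mat Carrierᴹ n
  keyMatrix B A z i j =
    ι (toℚ ((transposeℤ B ·ℤ A) i j)) +ᴹ diagᴹ (λ k → toℚ (+ 2) *ₗ tBz B z k) i j

  EvenIntegral : ∀ {n} → Mat Carrierᴹ n → Set ℓ
  EvenIntegral T = (∀ i j → IsInt (T i j)) × (∀ i → IsEvenInt (T i i))

-- For ⇒, write y = Vw and put D = U⁻¹τV; from τVQ = UP one gets DQ = P,
--     so D is diagonal with D_jj q_j = p_j, and u = U⁻¹τy = Dw gives p_j w_j = u_j q_j;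
--     coprimality of p_j and q_j yields q_j ∣ w_j, i.e. y ∈ VQℤⁿ = Bℤⁿ.
-- (b) Testing the condition defining L on x = 0 and x = e_i shows f(y) ∈ ℤ and τy ∈ ℤⁿ
--     (q ↦ q·e is injective as e ≠ 0), and (a) gives y ∈ Bℤⁿ; conversely ᵗxτBk = ᵗxAk ∈ ℤ.
-- (c) With S = ᵗBA = ᵗBτB (symmetric) and w = ᵗBz one has f(Bk) = ½ ᵗkSk + ᵗkw.  If L = Bℤⁿ,
--     then S_ii + 2w_i = 2 f(Be_i) ∈ 2ℤ.  Conversely ᵗkSk ≡ Σ_l k_l S_ll (mod 2) gives
--     f(Bk) ≡ Σ_l k_l (½ S_ll + w_l) modulo ℤ, which is integral when K is even, and (b)
--     concludes.

module Submission where

open import Defs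
open import Level using (Level)
open import Data.Nat as ℕ using (ℕ; zero; suc)
open import Data.Fin using (Fin; zero; suc; _≟_)
open import Data.Fin.Properties using (suc-injective)
open import Data.Bool using (if_then_else_; true; false)
open import Data.Integer as ℤ using (ℤ; +_)
import Data.Integer.Properties as ℤP
open import Data.Integer.DivMod using (a≡a%n+[a/n]*n; n%d<d)
open import Data.Integer.Tactic.RingSolver using (solve-∀) renaming (solve to ℤ-solve)
open import Data.List using (_∷_; [])
open import Data.Rational as ℚ using (ℚ; mkℚ; ↥_)
import Data.Rational.Properties as ℚP
import Data.Nat.Coprimality as ℕC
import Data.Integer.Coprimality as ℤC
open import Data.Integer.Coprimality using (coprime-divisor)
open import Data.Integer.Divisibility.Signed using (_∣_; divides; quotient; ∣ᵤ⇒∣; ∣⇒∣ᵤ)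
open import Algebra.Bundles using (CommutativeMonoid; CommutativeRing)
open import Function using (_∘_)
open import Relation.Binary.PropositionalEquality as ≡ using (_≡_; _≢_)
open import Data.Product using (Σ; ∃; _×_; _,_; proj₁; proj₂)
open import Relation.Nullary using (Dec; does; yes; no; ¬_)
open import Data.Rational.Properties using (+-*-ring)
open import Algebra.Module.Bundles using (LeftModule)
open import Function.Bundles using (_⇔_; mk⇔; Equivalence)
open import Data.Empty using (⊥-elim)

module _ {a} {A : Set a} {n : ℕ} (i j : Fin n) (x y : A) where

  select-≡ : i ≡ j → (if does (i ≟ j) then x else y) ≡ x
  select-≡ i≡j with i ≟ j
  ... | yes _ = ≡.refl
  ... | no i≢j = ⊥-elim (i≢j i≡j)

  select-≢ : i ≢ j → (if does (i ≟ j) then x else y) ≡ y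
  select-≢ i≢j with i ≟ j
  ... | yes i≡j = ⊥-elim (i≢j i≡j)
  ... | no _ = ≡.refl

module MonoidSums {a ℓ} (M : CommutativeMonoid a ℓ) where
  open CommutativeMonoid M renaming (_∙_ to _+_; ε to 0#; ∙-cong to +-cong;
    identityʳ to +-identityʳ; identityˡ to +-identityˡ)
  open import Algebra.Properties.CommutativeMonoid.Sum M public using (sum; ∑-comm; ∑-distrib-+)
  open import Algebra.Properties.CommutativeMonoid.Sum M using (sum-cong-≋; sum-replicate-zero)
  open import Algebra.Solver.CommutativeMonoid M using (solve; _⊕_; _⊜_)
  open import Relation.Binary.Reasoning.Setoid setoid

  -- Every operator given by the recursion of `sum` agrees with `sum`;
  -- this identifies the sums written out in the definitions with the library's.
  sum-unique : (s : ∀ {n} → (Fin n → Carrier) → Carrier) →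
    (∀ (f : Fin 0 → Carrier) → s f ≈ 0#) →
    (∀ {n} (f : Fin (suc n) → Carrier) → s f ≈ f zero + s (f ∘ suc)) →
    ∀ {n} (f : Fin n → Carrier) → s f ≈ sum f
  sum-unique s base step {zero} f = base f
  sum-unique s base step {suc n} f = trans (step f) (+-cong refl (sum-unique s base step (f ∘ suc)))

  sum-cong : ∀ {n} {f g : Fin n → Carrier} → (∀ i → f i ≈ g i) → sum f ≈ sum g
  sum-cong = sum-cong-≋

  sum-zero : ∀ {n} (f : Fin n → Carrier) → (∀ i → f i ≈ 0#) → sum f ≈ 0#
  sum-zero {n} f f≈0 = trans (sum-cong f≈0) (sum-replicate-zero n)

  sum-single : ∀ {n} (f : Fin n → Carrier) (j : Fin n) → (∀ i → i ≢ j → f i ≈ 0#) → sum f ≈ f j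
  sum-single f zero vanish =
    trans (+-cong refl (sum-zero (f ∘ suc) (λ i → vanish (suc i) λ ()))) (+-identityʳ _)
  sum-single f (suc j) vanish =
    trans (+-cong (vanish zero λ ()) (sum-single (f ∘ suc) j (λ i i≢j → vanish (suc i) (i≢j ∘ suc-injective))))
          (+-identityˡ _)

  symmetric-double-sum : ∀ {n} (T : Fin n → Fin n → Carrier) → (∀ i j → T i j ≈ T j i) →
    Σ Carrier λ X → sum (λ i → sum (T i)) ≈ sum (λ i → T i i) + (X + X)
  symmetric-double-sum {zero} T _ = 0# , sym (trans (+-identityˡ _) (+-identityˡ 0#))
  symmetric-double-sum {suc n} T T-sym with symmetric-double-sum (λ i j → T (suc i) (suc j)) (λ i j → T-sym (suc i) (suc j))
  ... | X , inner = (row + X) , (begin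
      (T zero zero + row) + sum (λ i → T (suc i) zero + sum (λ j → T (suc i) (suc j)))
        ≈⟨ +-cong refl (∑-distrib-+ (λ i → T (suc i) zero) (λ i → sum (λ j → T (suc i) (suc j)))) ⟩
      (T zero zero + row) + (sum (λ i → T (suc i) zero) + sum (λ i → sum (λ j → T (suc i) (suc j))))
        ≈⟨ +-cong refl (+-cong (sum-cong (λ i → T-sym (suc i) zero)) inner) ⟩
      (T zero zero + row) + (row + (diagonal + (X + X)))
        ≈⟨ solve 4 (λ t r d x → (t ⊕ r) ⊕ (r ⊕ (d ⊕ (x ⊕ x))) ⊜ (t ⊕ d) ⊕ ((r ⊕ x) ⊕ (r ⊕ x))) refl (T zero zero) row diagonal X ⟩
      (T zero zero + diagonal) + ((row + X) + (row + X)) ∎)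
    where
    row = sum (λ j → T zero (suc j))
    diagonal = sum (λ i → T (suc i) (suc i))

module Matrices {c ℓ} (R : CommutativeRing c ℓ) where
  open CommutativeRing R
  open MonoidSums +-commutativeMonoid public
  open import Algebra.Properties.Semiring.Sum semiring public using (*-distribˡ-sum; *-distribʳ-sum)
  open import Relation.Binary.Bundles using (Setoid)
  open import Relation.Binary.Reasoning.Setoid setoid

  private variable n : ℕ

  infix 4 _≐_ _≋_
  infixl 7 _⊛_ _⊛ᵛ_

  _≐_ : Vect Carrier n → Vect Carrier n → Set ℓ
  u ≐ v = ∀ i → u i ≈ v i

  _≋_ : Mat Carrier n → Mat Carrier n → Set ℓ
  M ≋ N = ∀ i j → M i j ≈ N i j

  ≋-setoid : ℕ → Setoid c ℓ
  ≋-setoid n = record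
    { Carrier = Mat Carrier n
    ; _≈_ = _≋_
    ; isEquivalence = record
      { refl = λ i j → refl
      ; sym = λ M≋N i j → sym (M≋N i j)
      ; trans = λ M≋N N≋P i j → trans (M≋N i j) (N≋P i j) } }

  dot : Vect Carrier n → Vect Carrier n → Carrier
  dot u v = sum (λ i → u i * v i)

  _⊛ᵛ_ : Mat Carrier n → Vect Carrier n → Vect Carrier n
  (M ⊛ᵛ v) i = dot (M i) v

  column : Mat Carrier n → Fin n → Vect Carrier n
  column M j i = M i j

  _⊛_ : Mat Carrier n → Mat Carrier n → Mat Carrier n
  (M ⊛ N) i j = (M ⊛ᵛ column N j) i

  transpose : Mat Carrier n → Mat Carrier n
  transpose M i j = M j i

  𝟙 : Mat Carrier n
  𝟙 i j = if does (i ≟ j) then 1# else 0#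

  diag : Vect Carrier n → Mat Carrier n
  diag d i j = if does (i ≟ j) then d i else 0#

  bilin : Vect Carrier n → Mat Carrier n → Vect Carrier n → Carrier
  bilin u M v = dot u (M ⊛ᵛ v)

  dot-cong : {u u' v v' : Vect Carrier n} → u ≐ u' → v ≐ v' → dot u v ≈ dot u' v'
  dot-cong u≐u' v≐v' = sum-cong (λ i → *-cong (u≐u' i) (v≐v' i))

  dot-comm : (u v : Vect Carrier n) → dot u v ≈ dot v u
  dot-comm u v = sum-cong (λ i → *-comm (u i) (v i))

  ⊛ᵛ-congˡ : {M N : Mat Carrier n} (v : Vect Carrier n) → M ≋ N → M ⊛ᵛ v ≐ N ⊛ᵛ v
  ⊛ᵛ-congˡ v M≋N i = dot-cong (M≋N i) (λ _ → refl)

  ⊛ᵛ-congʳ : (M : Mat Carrier n) {u v : Vect Carrier n} → u ≐ v → M ⊛ᵛ u ≐ M ⊛ᵛ v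
  ⊛ᵛ-congʳ M u≐v i = dot-cong (λ _ → refl) u≐v

  ⊛-congˡ : {M N : Mat Carrier n} (P : Mat Carrier n) → M ≋ N → M ⊛ P ≋ N ⊛ P
  ⊛-congˡ P M≋N i j = dot-cong (M≋N i) (λ _ → refl)

  ⊛-congʳ : (M : Mat Carrier n) {N P : Mat Carrier n} → N ≋ P → M ⊛ N ≋ M ⊛ P
  ⊛-congʳ M N≋P i j = dot-cong (λ _ → refl) (λ k → N≋P k j)

  dot-adjoint : (u : Vect Carrier n) (M : Mat Carrier n) (v : Vect Carrier n) →
    dot u (M ⊛ᵛ v) ≈ dot (transpose M ⊛ᵛ u) v
  dot-adjoint u M v = begin
    sum (λ i → u i * sum (λ k → M i k * v k))   ≈⟨ sum-cong (λ i → *-distribˡ-sum (u i) (λ k → M i k * v k)) ⟩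
    sum (λ i → sum (λ k → u i * (M i k * v k))) ≈⟨ sum-cong (λ i → sum-cong (λ k → regroup (u i) (M i k) (v k))) ⟩
    sum (λ i → sum (λ k → (M i k * u i) * v k)) ≈⟨ ∑-comm (λ i k → (M i k * u i) * v k) ⟩
    sum (λ k → sum (λ i → (M i k * u i) * v k)) ≈⟨ sum-cong (λ k → sym (*-distribʳ-sum (v k) (λ i → M i k * u i))) ⟩
    sum (λ k → sum (λ i → M i k * u i) * v k)   ∎
    where
    regroup : ∀ x y z → x * (y * z) ≈ (y * x) * z
    regroup x y z = trans (sym (*-assoc x y z)) (*-congʳ (*-comm x y))

  ⊛ᵛ-assoc : (M N : Mat Carrier n) (v : Vect Carrier n) → M ⊛ N ⊛ᵛ v ≐ M ⊛ᵛ (N ⊛ᵛ v)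
  ⊛ᵛ-assoc M N v i = sym (trans (dot-adjoint (M i) N v)
    (dot-cong (λ k → dot-comm (column N k) (M i)) (λ _ → refl)))

  ⊛-assoc : (M N P : Mat Carrier n) → M ⊛ N ⊛ P ≋ M ⊛ (N ⊛ P)
  ⊛-assoc M N P i j = ⊛ᵛ-assoc M N (column P j) i

  dot-unit : (i : Fin n) (v : Vect Carrier n) → dot (𝟙 i) v ≈ v i
  dot-unit i v = trans (sum-single (λ k → 𝟙 i k * v k) i off-i)
    (trans (*-congʳ (reflexive (select-≡ i i 1# 0# ≡.refl))) (*-identityˡ (v i)))
    where
    off-i : ∀ k → k ≢ i → 𝟙 i k * v k ≈ 0#
    off-i k k≢i = trans (*-congʳ (reflexive (select-≢ i k 1# 0# (k≢i ∘ ≡.sym)))) (zeroˡ (v k))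

  𝟙-⊛ᵛ : (v : Vect Carrier n) → 𝟙 ⊛ᵛ v ≐ v
  𝟙-⊛ᵛ v i = dot-unit i v

  𝟙-⊛ : (M : Mat Carrier n) → 𝟙 ⊛ M ≋ M
  𝟙-⊛ M i j = dot-unit i (column M j)

  ⊛-diag : (M : Mat Carrier n) (d : Vect Carrier n) → ∀ i j → (M ⊛ diag d) i j ≈ M i j * d j
  ⊛-diag M d i j = trans (sum-single (λ k → M i k * diag d k j) j off-j)
    (*-congˡ (reflexive (select-≡ j j (d j) 0# ≡.refl)))
    where
    off-j : ∀ k → k ≢ j → M i k * diag d k j ≈ 0#
    off-j k k≢j = trans (*-congˡ (reflexive (select-≢ k j (d k) 0# k≢j))) (zeroʳ (M i k))

  diag-⊛ᵛ : (d v : Vect Carrier n) → diag d ⊛ᵛ v ≐ λ i → d i * v i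
  diag-⊛ᵛ d v i = trans (sum-single (λ k → diag d i k * v k) i off-i)
    (*-congʳ (reflexive (select-≡ i i (d i) 0# ≡.refl)))
    where
    off-i : ∀ k → k ≢ i → diag d i k * v k ≈ 0#
    off-i k k≢i = trans (*-congʳ (reflexive (select-≢ i k (d i) 0# (k≢i ∘ ≡.sym)))) (zeroˡ (v k))

  dot-⊛ᵛ : (M N : Mat Carrier n) (u v : Vect Carrier n) →
    dot (M ⊛ᵛ u) (N ⊛ᵛ v) ≈ bilin u (transpose M ⊛ N) v
  dot-⊛ᵛ M N u v = begin
    dot (M ⊛ᵛ u) (N ⊛ᵛ v)               ≈⟨ dot-comm (M ⊛ᵛ u) (N ⊛ᵛ v) ⟩
    dot (N ⊛ᵛ v) (M ⊛ᵛ u)               ≈⟨ dot-adjoint (N ⊛ᵛ v) M u ⟩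
    dot (transpose M ⊛ᵛ (N ⊛ᵛ v)) u     ≈⟨ dot-cong (λ i → sym (⊛ᵛ-assoc (transpose M) N v i)) (λ _ → refl) ⟩
    dot (transpose M ⊛ N ⊛ᵛ v) u        ≈⟨ dot-comm (transpose M ⊛ N ⊛ᵛ v) u ⟩
    bilin u (transpose M ⊛ N) v         ∎

  bilin-sym : (τ : Mat Carrier n) → (∀ i j → τ i j ≈ τ j i) → (u v : Vect Carrier n) →
    bilin u τ v ≈ bilin v τ u
  bilin-sym τ τ-sym u v = begin
    dot u (τ ⊛ᵛ v)             ≈⟨ dot-adjoint u τ v ⟩
    dot (transpose τ ⊛ᵛ u) v   ≈⟨ dot-cong (⊛ᵛ-congˡ u (λ i j → τ-sym j i)) (λ _ → refl) ⟩
    dot (τ ⊛ᵛ u) v             ≈⟨ dot-comm (τ ⊛ᵛ u) v ⟩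
    dot v (τ ⊛ᵛ u)             ∎

  congruence-sym : (τ B : Mat Carrier n) → (∀ i j → τ i j ≈ τ j i) →
    ∀ i j → (transpose B ⊛ (τ ⊛ B)) i j ≈ (transpose B ⊛ (τ ⊛ B)) j i
  congruence-sym τ B τ-sym i j = bilin-sym τ τ-sym (column B i) (column B j)

module ℤM = Matrices ℤP.+-*-commutativeRing
module ℚM = Matrices ℚP.+-*-commutativeRing

toℚ≡mkℚ : ∀ k → toℚ k ≡ mkℚ k 0 (ℕC.sym (ℕC.1-coprimeTo _))
toℚ≡mkℚ k = ℚP.↥p/↧p≡p (mkℚ k 0 (ℕC.sym (ℕC.1-coprimeTo _)))

toℚ-injective : ∀ {a b} → toℚ a ≡ toℚ b → a ≡ b
toℚ-injective {a} {b} eq = begin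
  a                   ≡⟨ ≡.cong ↥_ (toℚ≡mkℚ a) ⟨
  ↥ toℚ a             ≡⟨ ≡.cong ↥_ eq ⟩
  ↥ toℚ b             ≡⟨ ≡.cong ↥_ (toℚ≡mkℚ b) ⟩
  b                   ∎
  where open ≡.≡-Reasoning

toℚ-+ : ∀ a b → toℚ (a ℤ.+ b) ≡ toℚ a ℚ.+ toℚ b
toℚ-+ a b rewrite toℚ≡mkℚ a | toℚ≡mkℚ b =
  ≡.cong (ℚ._/ 1) (≡.sym (≡.cong₂ ℤ._+_ (ℤP.*-identityʳ a) (ℤP.*-identityʳ b)))

toℚ-* : ∀ a b → toℚ (a ℤ.* b) ≡ toℚ a ℚ.* toℚ b
toℚ-* a b rewrite toℚ≡mkℚ a | toℚ≡mkℚ b = ≡.refl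

toℚ-sum : ∀ {n} (f : Fin n → ℤ) → toℚ (ℤM.sum f) ≡ ℚM.sum (toℚ ∘ f)
toℚ-sum {zero} f = ≡.refl
toℚ-sum {suc n} f = ≡.trans (toℚ-+ (f zero) _) (≡.cong (toℚ (f zero) ℚ.+_) (toℚ-sum (f ∘ suc)))

toℚ-dot : ∀ {n} (u v : Vect ℤ n) → toℚ (ℤM.dot u v) ≡ ℚM.dot (castVec u) (castVec v)
toℚ-dot u v = ≡.trans (toℚ-sum (λ i → u i ℤ.* v i)) (ℚM.sum-cong (λ i → toℚ-* (u i) (v i)))

cast-⊛ᵛ : ∀ {n} (M : Mat ℤ n) (v : Vect ℤ n) → castVec (M ℤM.⊛ᵛ v) ℚM.≐ castMat M ℚM.⊛ᵛ castVec v
cast-⊛ᵛ M v i = toℚ-dot (M i) v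

cast-⊛ : ∀ {n} (M N : Mat ℤ n) → castMat (M ℤM.⊛ N) ℚM.≋ castMat M ℚM.⊛ castMat N
cast-⊛ M N i j = toℚ-dot (M i) (ℤM.column N j)

cast-𝟙 : ∀ {n} → castMat {n} ℤM.𝟙 ℚM.≋ ℚM.𝟙
cast-𝟙 i j with does (i ≟ j)
... | true = ≡.refl
... | false = ≡.refl

cast-diag : ∀ {n} (d : Vect ℤ n) → castMat (ℤM.diag d) ℚM.≋ ℚM.diag (castVec d)
cast-diag d i j with does (i ≟ j)
... | true = ≡.refl
... | false = ≡.refl

sumℤ≡sum : ∀ {n} (f : Fin n → ℤ) → sumℤ f ≡ ℤM.sum f
sumℤ≡sum = ℤM.sum-unique sumℤ (λ _ → ≡.refl) (λ _ → ≡.refl)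

sumℚ≡sum : ∀ {n} (f : Fin n → ℚ) → sumℚ f ≡ ℚM.sum f
sumℚ≡sum = ℚM.sum-unique sumℚ (λ _ → ≡.refl) (λ _ → ≡.refl)

·ℤ≋⊛ : ∀ {n} (M N : Mat ℤ n) → (M ·ℤ N) ℤM.≋ M ℤM.⊛ N
·ℤ≋⊛ M N i j = sumℤ≡sum (λ k → M i k ℤ.* N k j)

·ℤv≐⊛ᵛ : ∀ {n} (M : Mat ℤ n) (v : Vect ℤ n) → (M ·ℤv v) ℤM.≐ M ℤM.⊛ᵛ v
·ℤv≐⊛ᵛ M v i = sumℤ≡sum (λ k → M i k ℤ.* v k)

·ℚ≋⊛ : ∀ {n} (M N : Mat ℚ n) → (M ·ℚ N) ℚM.≋ M ℚM.⊛ N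
·ℚ≋⊛ M N i j = sumℚ≡sum (λ k → M i k ℚ.* N k j)

·ℚv≐⊛ᵛ : ∀ {n} (M : Mat ℚ n) (v : Vect ℚ n) → (M ·ℚv v) ℚM.≐ M ℚM.⊛ᵛ v
·ℚv≐⊛ᵛ M v i = sumℚ≡sum (λ k → M i k ℚ.* v k)

bilinℚ≡bilin : ∀ {n} (u : Vect ℚ n) (M : Mat ℚ n) (v : Vect ℚ n) → bilinℚ u M v ≡ ℚM.bilin u M v
bilinℚ≡bilin u M v = ≡.trans (sumℚ≡sum (λ i → u i ℚ.* (M ·ℚv v) i)) (ℚM.dot-cong {u = u} (λ _ → ≡.refl) (·ℚv≐⊛ᵛ M v))

half-even : ∀ d x → ℚ.½ ℚ.* toℚ (d ℤ.+ (x ℤ.+ x)) ≡ toℚ x ℚ.+ ℚ.½ ℚ.* toℚ d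
half-even d x = begin
  ℚ.½ ℚ.* toℚ (d ℤ.+ (x ℤ.+ x))                          ≡⟨ ≡.cong (ℚ.½ ℚ.*_) (≡.trans (toℚ-+ d _) (≡.cong (toℚ d ℚ.+_) (toℚ-+ x x))) ⟩
  ℚ.½ ℚ.* (toℚ d ℚ.+ (toℚ x ℚ.+ toℚ x))                  ≡⟨ ℚP.*-distribˡ-+ ℚ.½ (toℚ d) _ ⟩
  ℚ.½ ℚ.* toℚ d ℚ.+ ℚ.½ ℚ.* (toℚ x ℚ.+ toℚ x)            ≡⟨ ≡.cong (ℚ.½ ℚ.* toℚ d ℚ.+_) half-double ⟩
  ℚ.½ ℚ.* toℚ d ℚ.+ toℚ x                                ≡⟨ ℚP.+-comm _ (toℚ x) ⟩
  toℚ x ℚ.+ ℚ.½ ℚ.* toℚ d                                ∎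
  where
  open ≡.≡-Reasoning
  half-double : ℚ.½ ℚ.* (toℚ x ℚ.+ toℚ x) ≡ toℚ x
  half-double = ≡.trans (ℚP.*-distribˡ-+ ℚ.½ (toℚ x) (toℚ x))
    (≡.trans (≡.sym (ℚP.*-distribʳ-+ (toℚ x) ℚ.½ ℚ.½)) (ℚP.*-identityˡ (toℚ x)))

ℚ-*-cancelʳ-0 : ∀ x y → y ≢ ℚ.0ℚ → x ℚ.* y ≡ ℚ.0ℚ → x ≡ ℚ.0ℚ
ℚ-*-cancelʳ-0 x y y≢0 xy≡0 = begin
  x                        ≡⟨ ℚP.*-identityʳ x ⟨
  x ℚ.* ℚ.1ℚ               ≡⟨ ≡.cong (x ℚ.*_) (ℚP.*-inverseʳ y) ⟨
  x ℚ.* (y ℚ.* ℚ.1/ y)     ≡⟨ ℚP.*-assoc x y _ ⟨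
  (x ℚ.* y) ℚ.* ℚ.1/ y     ≡⟨ ≡.cong (ℚ._* ℚ.1/ y) xy≡0 ⟩
  ℚ.0ℚ ℚ.* ℚ.1/ y          ≡⟨ ℚP.*-zeroˡ (ℚ.1/ y) ⟩
  ℚ.0ℚ                     ∎
  where
  open ≡.≡-Reasoning
  instance
    y-nonZero : ℚ.NonZero y
    y-nonZero = ℚ.≢-nonZero y≢0

square-parity : ∀ k → ∃ λ y → k ℤ.* k ≡ k ℤ.+ (y ℤ.+ y)
square-parity k = ≡.subst SquareParity (≡.sym (a≡a%n+[a/n]*n k (+ 2)))
  (by-remainder (k ℤ.% + 2) (k ℤ./ + 2) (n%d<d k (+ 2)))
  where
  SquareParity : ℤ → Set
  SquareParity k = ∃ λ y → k ℤ.* k ≡ k ℤ.+ (y ℤ.+ y)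
  by-remainder : ∀ r q → r ℕ.< 2 → SquareParity (+ r ℤ.+ q ℤ.* + 2)
  by-remainder 0 q _ = q ℤ.* q ℤ.+ q ℤ.* q ℤ.- q , ℤ-solve (q ∷ [])
  by-remainder 1 q _ = q ℤ.+ q ℤ.* q ℤ.+ q ℤ.* q , ℤ-solve (q ∷ [])
  by-remainder (suc (suc r)) q (ℕ.s≤s (ℕ.s≤s ()))

diagonal-term-parity : ∀ k s → ∃ λ y → k ℤ.* (s ℤ.* k) ≡ k ℤ.* s ℤ.+ (y ℤ.+ y)
diagonal-term-parity k s = s ℤ.* h , (begin
  k ℤ.* (s ℤ.* k)                   ≡⟨ middle-out k s ⟩
  s ℤ.* (k ℤ.* k)                   ≡⟨ ≡.cong (s ℤ.*_) k²≡k+2h ⟩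
  s ℤ.* (k ℤ.+ (h ℤ.+ h))           ≡⟨ expand k s h ⟩
  k ℤ.* s ℤ.+ (s ℤ.* h ℤ.+ s ℤ.* h) ∎)
  where
  open ≡.≡-Reasoning
  h = proj₁ (square-parity k)
  k²≡k+2h = proj₂ (square-parity k)
  middle-out : ∀ a s → a ℤ.* (s ℤ.* a) ≡ s ℤ.* (a ℤ.* a)
  middle-out = solve-∀
  expand : ∀ a s h → s ℤ.* (a ℤ.+ (h ℤ.+ h)) ≡ a ℤ.* s ℤ.+ (s ℤ.* h ℤ.+ s ℤ.* h)
  expand = solve-∀

-- For a symmetric integer matrix S, ᵗkSk ≡ Σ_l k_l S_ll (mod 2): the off-diagonal terms
-- pair up, and each diagonal term is handled by diagonal-term-parity.
quadratic-parity : ∀ {n} (S : Mat ℤ n) → (∀ i j → S i j ≡ S j i) → (k : Vect ℤ n) →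
  ∃ λ X → ℤM.bilin k S k ≡ ℤM.dot k (λ l → S l l) ℤ.+ (X ℤ.+ X)
quadratic-parity S S-sym k = Y ℤ.+ X , (begin
  ℤM.bilin k S k                                       ≡⟨ ℤM.sum-cong (λ i → ℤM.*-distribˡ-sum (k i) (λ j → S i j ℤ.* k j)) ⟩
  ℤM.sum (λ i → ℤM.sum (T i))                          ≡⟨ proj₂ off-diagonal-pairs ⟩
  ℤM.sum (λ i → T i i) ℤ.+ (X ℤ.+ X)                   ≡⟨ ≡.cong (ℤ._+ (X ℤ.+ X)) (ℤM.sum-cong diagonal) ⟩
  ℤM.sum (λ l → k l ℤ.* S l l ℤ.+ (y l ℤ.+ y l)) ℤ.+ (X ℤ.+ X)
    ≡⟨ ≡.cong (ℤ._+ (X ℤ.+ X)) (ℤM.∑-distrib-+ (λ l → k l ℤ.* S l l) (λ l → y l ℤ.+ y l)) ⟩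
  Δ ℤ.+ ℤM.sum (λ l → y l ℤ.+ y l) ℤ.+ (X ℤ.+ X)       ≡⟨ ≡.cong (λ t → Δ ℤ.+ t ℤ.+ (X ℤ.+ X)) (ℤM.∑-distrib-+ y y) ⟩
  Δ ℤ.+ (Y ℤ.+ Y) ℤ.+ (X ℤ.+ X)                        ≡⟨ regroup Δ Y X ⟩
  Δ ℤ.+ ((Y ℤ.+ X) ℤ.+ (Y ℤ.+ X))                      ∎)
  where
  open ≡.≡-Reasoning
  T : Mat ℤ _
  T i j = k i ℤ.* (S i j ℤ.* k j)
  swap-ends : ∀ a b c → a ℤ.* (b ℤ.* c) ≡ c ℤ.* (b ℤ.* a)
  swap-ends = solve-∀
  T-sym : ∀ i j → T i j ≡ T j i
  T-sym i j = ≡.trans (≡.cong (λ s → k i ℤ.* (s ℤ.* k j)) (S-sym i j)) (swap-ends (k i) (S j i) (k j))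
  off-diagonal-pairs = ℤM.symmetric-double-sum T T-sym
  X = proj₁ off-diagonal-pairs
  y : Vect ℤ _
  y l = proj₁ (diagonal-term-parity (k l) (S l l))
  diagonal : ∀ l → T l l ≡ k l ℤ.* S l l ℤ.+ (y l ℤ.+ y l)
  diagonal l = proj₂ (diagonal-term-parity (k l) (S l l))
  Y = ℤM.sum y
  Δ = ℤM.dot k (λ l → S l l)
  regroup : ∀ d a x → d ℤ.+ (a ℤ.+ a) ℤ.+ (x ℤ.+ x) ≡ d ℤ.+ ((a ℤ.+ x) ℤ.+ (a ℤ.+ x))
  regroup = solve-∀

module ReducedFormFacts {n : ℕ} {τ : Mat ℚ n} {A B : Mat ℤ n} (rf : ReducedForm τ A B) where
  open ReducedForm rf

  U⁻¹ V⁻¹ : Mat ℤ n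
  U⁻¹ = proj₁ U-GL
  V⁻¹ = proj₁ V-GL

  V⊛V⁻¹ : V ℤM.⊛ V⁻¹ ℤM.≋ ℤM.𝟙
  V⊛V⁻¹ i j = ≡.trans (≡.sym (·ℤ≋⊛ V V⁻¹ i j)) (proj₁ (proj₂ V-GL) i j)

  U⁻¹⊛U : U⁻¹ ℤM.⊛ U ℤM.≋ ℤM.𝟙
  U⁻¹⊛U i j = ≡.trans (≡.sym (·ℤ≋⊛ U⁻¹ U i j)) (proj₂ (proj₂ U-GL) i j)

  B≋VQ : B ℤM.≋ V ℤM.⊛ ℤM.diag q
  B≋VQ i j = ≡.trans (B≡VQ i j) (·ℤ≋⊛ V (diagℤ q) i j)

  A≋UP : A ℤM.≋ U ℤM.⊛ ℤM.diag p
  A≋UP i j = ≡.trans (A≡UP i j) (·ℤ≋⊛ U (diagℤ p) i j)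

  τB≋A : τ ℚM.⊛ castMat B ℚM.≋ castMat A
  τB≋A i j = ≡.trans (≡.sym (·ℚ≋⊛ τ (castMat B) i j)) (τB≡A i j)

  τ-Bk : (k : Vect ℤ n) → τ ℚM.⊛ᵛ castVec (B ℤM.⊛ᵛ k) ℚM.≐ castVec (A ℤM.⊛ᵛ k)
  τ-Bk k i = begin
    (τ ℚM.⊛ᵛ castVec (B ℤM.⊛ᵛ k)) i              ≡⟨ ℚM.⊛ᵛ-congʳ τ (cast-⊛ᵛ B k) i ⟩
    (τ ℚM.⊛ᵛ (castMat B ℚM.⊛ᵛ castVec k)) i      ≡⟨ ℚM.⊛ᵛ-assoc τ (castMat B) (castVec k) i ⟨
    (τ ℚM.⊛ castMat B ℚM.⊛ᵛ castVec k) i         ≡⟨ ℚM.⊛ᵛ-congˡ (castVec k) τB≋A i ⟩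
    (castMat A ℚM.⊛ᵛ castVec k) i                ≡⟨ cast-⊛ᵛ A k i ⟨
    castVec (A ℤM.⊛ᵛ k) i                        ∎
    where open ≡.≡-Reasoning

  -- In the bases given by U and V, τ becomes P Q⁻¹: the matrix D = U⁻¹ τ V satisfies D Q = P.
  D : Mat ℚ n
  D = castMat U⁻¹ ℚM.⊛ (τ ℚM.⊛ castMat V)

  DQ≋P : D ℚM.⊛ castMat (ℤM.diag q) ℚM.≋ castMat (ℤM.diag p)
  DQ≋P = begin
    Û⁻¹ ⊛ (τ ⊛ V̂) ⊛ Q̂      ≈⟨ ℚM.⊛-assoc Û⁻¹ (τ ⊛ V̂) Q̂ ⟩
    Û⁻¹ ⊛ (τ ⊛ V̂ ⊛ Q̂)      ≈⟨ ℚM.⊛-congʳ Û⁻¹ (ℚM.⊛-assoc τ V̂ Q̂) ⟩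
    Û⁻¹ ⊛ (τ ⊛ (V̂ ⊛ Q̂))    ≈⟨ ℚM.⊛-congʳ Û⁻¹ (ℚM.⊛-congʳ τ V̂Q̂≋B̂) ⟩
    Û⁻¹ ⊛ (τ ⊛ castMat B)   ≈⟨ ℚM.⊛-congʳ Û⁻¹ τB≋A ⟩
    Û⁻¹ ⊛ castMat A         ≈⟨ ℚM.⊛-congʳ Û⁻¹ Â≋ÛP̂ ⟩
    Û⁻¹ ⊛ (castMat U ⊛ P̂)   ≈⟨ ℚM.⊛-assoc Û⁻¹ (castMat U) P̂ ⟨
    Û⁻¹ ⊛ castMat U ⊛ P̂     ≈⟨ ℚM.⊛-congˡ P̂ Û⁻¹Û≋𝟙 ⟩
    ℚM.𝟙 ⊛ P̂                ≈⟨ ℚM.𝟙-⊛ P̂ ⟩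
    P̂                       ∎
    where
    open ℚM using (_⊛_)
    open import Relation.Binary.Reasoning.Setoid (ℚM.≋-setoid n)
    Û⁻¹ V̂ P̂ Q̂ : Mat ℚ n
    Û⁻¹ = castMat U⁻¹
    V̂ = castMat V
    P̂ = castMat (ℤM.diag p)
    Q̂ = castMat (ℤM.diag q)
    V̂Q̂≋B̂ : V̂ ⊛ Q̂ ℚM.≋ castMat B
    V̂Q̂≋B̂ i j = ≡.trans (≡.sym (cast-⊛ V (ℤM.diag q) i j)) (≡.cong toℚ (≡.sym (B≋VQ i j)))
    Â≋ÛP̂ : castMat A ℚM.≋ castMat U ⊛ P̂
    Â≋ÛP̂ i j = ≡.trans (≡.cong toℚ (A≋UP i j)) (cast-⊛ U (ℤM.diag p) i j)
    Û⁻¹Û≋𝟙 : Û⁻¹ ⊛ castMat U ℚM.≋ ℚM.𝟙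
    Û⁻¹Û≋𝟙 i j = ≡.trans (≡.sym (cast-⊛ U⁻¹ U i j)) (≡.trans (≡.cong toℚ (U⁻¹⊛U i j)) (cast-𝟙 i j))

  D-scaled : ∀ j l → D j l ℚ.* toℚ (q l) ≡ toℚ (ℤM.diag p j l)
  D-scaled j l = begin
    D j l ℚ.* toℚ (q l)                         ≡⟨ ℚM.⊛-diag D (castVec q) j l ⟨
    (D ℚM.⊛ ℚM.diag (castVec q)) j l            ≡⟨ ℚM.⊛-congʳ D (λ i j → ≡.sym (cast-diag q i j)) j l ⟩
    (D ℚM.⊛ castMat (ℤM.diag q)) j l            ≡⟨ DQ≋P j l ⟩
    toℚ (ℤM.diag p j l)                         ∎
    where open ≡.≡-Reasoning

  q-nonzero : ∀ l → toℚ (q l) ≢ ℚ.0ℚ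
  q-nonzero l q≡0 = ℤP.<-irrefl (≡.sym (toℚ-injective q≡0)) (q-pos l)

  D-off-diagonal : ∀ j l → l ≢ j → D j l ≡ ℚ.0ℚ
  D-off-diagonal j l l≢j = ℚ-*-cancelʳ-0 (D j l) (toℚ (q l)) (q-nonzero l)
    (≡.trans (D-scaled j l) (≡.cong toℚ (select-≢ j l (p j) (+ 0) (l≢j ∘ ≡.sym))))

  D-diagonal : ∀ j → D j j ℚ.* toℚ (q j) ≡ toℚ (p j)
  D-diagonal j = ≡.trans (D-scaled j j) (≡.cong toℚ (select-≡ j j (p j) (+ 0) ≡.refl))

  D-⊛ᵛ : (v : Vect ℚ n) → ∀ j → (D ℚM.⊛ᵛ v) j ≡ D j j ℚ.* v j
  D-⊛ᵛ v j = ℚM.sum-single (λ l → D j l ℚ.* v l) j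
    (λ l l≢j → ≡.trans (≡.cong (ℚ._* v l) (D-off-diagonal j l l≢j)) (ℚP.*-zeroˡ (v l)))

  V-onto : (a : Vect ℤ n) → a ℤM.≐ V ℤM.⊛ᵛ (V⁻¹ ℤM.⊛ᵛ a)
  V-onto a i = ≡.sym (begin
    (V ⊛ᵛ (V⁻¹ ⊛ᵛ a)) i   ≡⟨ ℤM.⊛ᵛ-assoc V V⁻¹ a i ⟨
    (V ⊛ V⁻¹ ⊛ᵛ a) i      ≡⟨ ℤM.⊛ᵛ-congˡ a V⊛V⁻¹ i ⟩
    (ℤM.𝟙 ⊛ᵛ a) i         ≡⟨ ℤM.𝟙-⊛ᵛ a i ⟩
    a i                   ∎)
    where
    open ≡.≡-Reasoning
    open ℤM using (_⊛_; _⊛ᵛ_)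

  U⁻¹-coordinates : (w c : Vect ℤ n) → τ ℚM.⊛ᵛ castVec (V ℤM.⊛ᵛ w) ℚM.≐ castVec c →
    castVec (U⁻¹ ℤM.⊛ᵛ c) ℚM.≐ D ℚM.⊛ᵛ castVec w
  U⁻¹-coordinates w c τVw≐c j = begin
    toℚ ((U⁻¹ ℤM.⊛ᵛ c) j)                 ≡⟨ cast-⊛ᵛ U⁻¹ c j ⟩
    (Û⁻¹ ⊛ᵛ castVec c) j                  ≡⟨ ℚM.⊛ᵛ-congʳ Û⁻¹ (λ i → ≡.sym (τVw≐c i)) j ⟩
    (Û⁻¹ ⊛ᵛ (τ ⊛ᵛ castVec (V ℤM.⊛ᵛ w))) j ≡⟨ ℚM.⊛ᵛ-congʳ Û⁻¹ (ℚM.⊛ᵛ-congʳ τ (cast-⊛ᵛ V w)) j ⟩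
    (Û⁻¹ ⊛ᵛ (τ ⊛ᵛ (V̂ ⊛ᵛ ŵ))) j            ≡⟨ ℚM.⊛ᵛ-congʳ Û⁻¹ (λ i → ≡.sym (ℚM.⊛ᵛ-assoc τ V̂ ŵ i)) j ⟩
    (Û⁻¹ ⊛ᵛ (τ ⊛ V̂ ⊛ᵛ ŵ)) j               ≡⟨ ℚM.⊛ᵛ-assoc Û⁻¹ (τ ⊛ V̂) ŵ j ⟨
    (D ⊛ᵛ ŵ) j                            ∎
    where
    open ≡.≡-Reasoning
    open ℚM using (_⊛_; _⊛ᵛ_)
    Û⁻¹ V̂ : Mat ℚ n
    Û⁻¹ = castMat U⁻¹
    V̂ = castMat V
    ŵ : Vect ℚ n
    ŵ = castVec w

  pw≡uq : (w u : Vect ℤ n) → castVec u ℚM.≐ D ℚM.⊛ᵛ castVec w → ∀ j → p j ℤ.* w j ≡ u j ℤ.* q j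
  pw≡uq w u û≐Dŵ j = toℚ-injective (begin
    toℚ (p j ℤ.* w j)                          ≡⟨ toℚ-* (p j) (w j) ⟩
    toℚ (p j) ℚ.* toℚ (w j)                    ≡⟨ ≡.cong (ℚ._* toℚ (w j)) (D-diagonal j) ⟨
    D j j ℚ.* toℚ (q j) ℚ.* toℚ (w j)          ≡⟨ ℚP.*-assoc (D j j) _ _ ⟩
    D j j ℚ.* (toℚ (q j) ℚ.* toℚ (w j))        ≡⟨ ≡.cong (D j j ℚ.*_) (ℚP.*-comm (toℚ (q j)) _) ⟩
    D j j ℚ.* (toℚ (w j) ℚ.* toℚ (q j))        ≡⟨ ℚP.*-assoc (D j j) _ _ ⟨
    D j j ℚ.* toℚ (w j) ℚ.* toℚ (q j)          ≡⟨ ≡.cong (ℚ._* toℚ (q j)) (≡.trans (û≐Dŵ j) (D-⊛ᵛ (castVec w) j)) ⟨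
    toℚ (u j) ℚ.* toℚ (q j)                    ≡⟨ toℚ-* (u j) (q j) ⟨
    toℚ (u j ℤ.* q j)                          ∎)
    where open ≡.≡-Reasoning

  Vw∈Bℤ : (w : Vect ℤ n) → (∀ j → q j ∣ w j) → Σ (Vect ℤ n) λ k → V ℤM.⊛ᵛ w ℤM.≐ B ℤM.⊛ᵛ k
  Vw∈Bℤ w q∣w = k , λ i → begin
    (V ⊛ᵛ w) i                    ≡⟨ ℤM.⊛ᵛ-congʳ V w≐Qk i ⟩
    (V ⊛ᵛ (ℤM.diag q ⊛ᵛ k)) i     ≡⟨ ℤM.⊛ᵛ-assoc V (ℤM.diag q) k i ⟨
    (V ⊛ ℤM.diag q ⊛ᵛ k) i        ≡⟨ ℤM.⊛ᵛ-congˡ k B≋VQ i ⟨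
    (B ⊛ᵛ k) i                    ∎
    where
    open ≡.≡-Reasoning
    open ℤM using (_⊛_; _⊛ᵛ_)
    k : Vect ℤ n
    k j = quotient (q∣w j)
    w≐Qk : w ℤM.≐ ℤM.diag q ⊛ᵛ k
    w≐Qk j = ≡.trans (_∣_.equality (q∣w j))
      (≡.trans (ℤP.*-comm (k j) (q j)) (≡.sym (ℤM.diag-⊛ᵛ q k j)))

  -- Part (a), forward direction: if a ∈ ℤⁿ and τa = c ∈ ℤⁿ then a ∈ Bℤⁿ.  With w = V⁻¹a
  -- and u = U⁻¹c one has u = Dw, so p_j w_j = u_j q_j and coprimality gives q_j ∣ w_j.
  integral⇒Bℤ : (a c : Vect ℤ n) → τ ℚM.⊛ᵛ castVec a ℚM.≐ castVec c →
    Σ (Vect ℤ n) λ k → a ℤM.≐ B ℤM.⊛ᵛ k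
  integral⇒Bℤ a c τa≐c = k , λ i → ≡.trans (V-onto a i) (Vw≐Bk i)
    where
    w u : Vect ℤ n
    w = V⁻¹ ℤM.⊛ᵛ a
    u = U⁻¹ ℤM.⊛ᵛ c
    τVw≐c : τ ℚM.⊛ᵛ castVec (V ℤM.⊛ᵛ w) ℚM.≐ castVec c
    τVw≐c i = ≡.trans (ℚM.⊛ᵛ-congʳ τ (λ j → ≡.cong toℚ (≡.sym (V-onto a j))) i) (τa≐c i)
    q∣w : ∀ j → q j ∣ w j
    q∣w j = ∣ᵤ⇒∣ (coprime-divisor (q j) (p j) (w j) (ℤC.sym {p j} {q j} (pq-coprime j))
      (∣⇒∣ᵤ (divides (u j) (pw≡uq w u (U⁻¹-coordinates w c τVw≐c) j))))
    k = proj₁ (Vw∈Bℤ w q∣w)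
    Vw≐Bk = proj₂ (Vw∈Bℤ w q∣w)

  part-a : (y : Vect ℚ n) → (IsIntVecℚ y × IsIntVecℚ (τ ·ℚv y)) ⇔ InBZℚ B y
  part-a y = mk⇔ integral⇒ ⇒integral
    where
    integral⇒ : IsIntVecℚ y × IsIntVecℚ (τ ·ℚv y) → InBZℚ B y
    integral⇒ (y-int , τy-int) = k , λ i →
      ≡.trans (proj₂ (y-int i)) (≡.cong toℚ (≡.trans (a≐Bk i) (≡.sym (·ℤv≐⊛ᵛ B k i))))
      where
      a c : Vect ℤ n
      a i = proj₁ (y-int i)
      c i = proj₁ (τy-int i)
      τâ≐ĉ : τ ℚM.⊛ᵛ castVec a ℚM.≐ castVec c
      τâ≐ĉ i = ≡.trans (ℚM.⊛ᵛ-congʳ τ (λ j → ≡.sym (proj₂ (y-int j))) i)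
        (≡.trans (≡.sym (·ℚv≐⊛ᵛ τ y i)) (proj₂ (τy-int i)))
      k = proj₁ (integral⇒Bℤ a c τâ≐ĉ)
      a≐Bk = proj₂ (integral⇒Bℤ a c τâ≐ĉ)
    ⇒integral : InBZℚ B y → IsIntVecℚ y × IsIntVecℚ (τ ·ℚv y)
    ⇒integral (k , y≡Bk) = (λ i → (B ·ℤv k) i , y≡Bk i) , (λ i → (A ℤM.⊛ᵛ k) i , τy≡Ak i)
      where
      y≐B̂k : y ℚM.≐ castVec (B ℤM.⊛ᵛ k)
      y≐B̂k i = ≡.trans (y≡Bk i) (≡.cong toℚ (·ℤv≐⊛ᵛ B k i))
      τy≡Ak : ∀ i → (τ ·ℚv y) i ≡ toℚ ((A ℤM.⊛ᵛ k) i)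
      τy≡Ak i = ≡.trans (·ℚv≐⊛ᵛ τ y i) (≡.trans (ℚM.⊛ᵛ-congʳ τ y≐B̂k i) (τ-Bk k i))

module CoefficientSpace {m ℓ : Level} (M : LeftModule ℚP.+-*-ring m ℓ) (e : LeftModule.Carrierᴹ M)
  (e≉0 : ¬ LeftModule._≈ᴹ_ M e (LeftModule.0ᴹ M)) where
  open LeftModule M
  open Coeff M e
  module ΣM = MonoidSums +ᴹ-commutativeMonoid
  open import Algebra.Properties.Group +ᴹ-group using (identityˡ-unique)
  open import Algebra.Properties.Group ℚP.+-0-group using (x∙y⁻¹≈ε⇒x≈y; //-rightDividesˡ)
  open import Relation.Binary.Reasoning.Setoid ≈ᴹ-setoid

  ι-cong : ∀ {r s} → r ≡ s → ι r ≈ᴹ ι s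
  ι-cong ≡.refl = ≈ᴹ-refl

  ι-+ : ∀ r s → ι (r ℚ.+ s) ≈ᴹ ι r +ᴹ ι s
  ι-+ r s = *ₗ-distribʳ e r s

  ι-* : ∀ r s → r *ₗ ι s ≈ᴹ ι (r ℚ.* s)
  ι-* r s = ≈ᴹ-sym (*ₗ-assoc r s e)

  -- Because e ≠ 0 and ℚ is a field, ι has trivial kernel, hence is injective.
  ι-kernel : ∀ d → ι d ≈ᴹ 0ᴹ → d ≡ ℚ.0ℚ
  ι-kernel d ιd≈0 with d ℚP.≟ ℚ.0ℚ
  ... | yes d≡0 = d≡0
  ... | no d≢0 = ⊥-elim (e≉0 (begin
    e                       ≈⟨ *ₗ-identityˡ e ⟨
    ℚ.1ℚ *ₗ e               ≈⟨ ι-cong (ℚP.*-inverseˡ d) ⟨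
    (ℚ.1/ d ℚ.* d) *ₗ e     ≈⟨ *ₗ-assoc (ℚ.1/ d) d e ⟩
    ℚ.1/ d *ₗ ι d           ≈⟨ *ₗ-congˡ ιd≈0 ⟩
    ℚ.1/ d *ₗ 0ᴹ            ≈⟨ *ₗ-zeroʳ (ℚ.1/ d) ⟩
    0ᴹ                      ∎))
    where
    instance
      d-nonZero : ℚ.NonZero d
      d-nonZero = ℚ.≢-nonZero d≢0

  ι-injective : ∀ r s → ι r ≈ᴹ ι s → r ≡ s
  ι-injective r s ιr≈ιs = x∙y⁻¹≈ε⇒x≈y r s (ι-kernel (r ℚ.- s) (identityˡ-unique (ι (r ℚ.- s)) (ι s) (begin
    ι (r ℚ.- s) +ᴹ ι s      ≈⟨ ι-+ (r ℚ.- s) s ⟨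
    ι (r ℚ.- s ℚ.+ s)       ≈⟨ ι-cong (//-rightDividesˡ s r) ⟩
    ι r                     ≈⟨ ιr≈ιs ⟩
    ι s                     ∎)))

  sumᴹ≈sum : ∀ {n} (f : Fin n → Carrierᴹ) → sumᴹ f ≈ᴹ ΣM.sum f
  sumᴹ≈sum = ΣM.sum-unique sumᴹ (λ _ → ≈ᴹ-refl) (λ _ → ≈ᴹ-refl)

  ι-sum : ∀ {n} (g : Fin n → ℚ) → ι (ℚM.sum g) ≈ᴹ ΣM.sum (ι ∘ g)
  ι-sum {zero} g = *ₗ-zeroˡ e
  ι-sum {suc n} g = ≈ᴹ-trans (ι-+ (g zero) _) (+ᴹ-congˡ (ι-sum (g ∘ suc)))

  *ₗ-sum : ∀ {n} r (f : Fin n → Carrierᴹ) → r *ₗ ΣM.sum f ≈ᴹ ΣM.sum (λ i → r *ₗ f i)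
  *ₗ-sum {zero} r f = *ₗ-zeroʳ r
  *ₗ-sum {suc n} r f = ≈ᴹ-trans (*ₗ-distribˡ r (f zero) _) (+ᴹ-congˡ (*ₗ-sum r (f ∘ suc)))

  sum-*ₗ : ∀ {n} (g : Fin n → ℚ) v → ℚM.sum g *ₗ v ≈ᴹ ΣM.sum (λ i → g i *ₗ v)
  sum-*ₗ {zero} g v = *ₗ-zeroˡ v
  sum-*ₗ {suc n} g v = ≈ᴹ-trans (*ₗ-distribʳ v (g zero) _) (+ᴹ-congˡ (sum-*ₗ (g ∘ suc) v))

  IsInt-resp : ∀ {u v} → u ≈ᴹ v → IsInt u → IsInt v
  IsInt-resp u≈v (a , u≈a) = a , ≈ᴹ-trans (≈ᴹ-sym u≈v) u≈a

  IsEvenInt-resp : ∀ {u v} → u ≈ᴹ v → IsEvenInt u → IsEvenInt v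
  IsEvenInt-resp u≈v (m , u≈2m) = m , ≈ᴹ-trans (≈ᴹ-sym u≈v) u≈2m

  IsInt-+ : ∀ {u v} → IsInt u → IsInt v → IsInt (u +ᴹ v)
  IsInt-+ {u} {v} (a , u≈a) (b , v≈b) = a ℤ.+ b , (begin
    u +ᴹ v                      ≈⟨ +ᴹ-cong u≈a v≈b ⟩
    ι (toℚ a) +ᴹ ι (toℚ b)      ≈⟨ ι-+ (toℚ a) (toℚ b) ⟨
    ι (toℚ a ℚ.+ toℚ b)         ≈⟨ ι-cong (toℚ-+ a b) ⟨
    ι (toℚ (a ℤ.+ b))           ∎)

  IsInt-*ₗ : ∀ k {v} → IsInt v → IsInt (toℚ k *ₗ v)
  IsInt-*ₗ k {v} (a , v≈a) = k ℤ.* a , (begin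
    toℚ k *ₗ v                  ≈⟨ *ₗ-congˡ v≈a ⟩
    toℚ k *ₗ ι (toℚ a)          ≈⟨ ι-* (toℚ k) (toℚ a) ⟩
    ι (toℚ k ℚ.* toℚ a)         ≈⟨ ι-cong (toℚ-* k a) ⟨
    ι (toℚ (k ℤ.* a))           ∎)

  IsInt-sum : ∀ {n} (f : Fin n → Carrierᴹ) → (∀ i → IsInt (f i)) → IsInt (ΣM.sum f)
  IsInt-sum {zero} f _ = + 0 , ≈ᴹ-sym (*ₗ-zeroˡ e)
  IsInt-sum {suc n} f f-int = IsInt-+ (f-int zero) (IsInt-sum (f ∘ suc) (f-int ∘ suc))

  IsInt-difference : ∀ {u} r → IsInt u → IsInt (u +ᴹ ι r) → ∃ λ k → r ≡ toℚ k
  IsInt-difference {u} r (a , u≈a) (b , u+r≈b) =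
    b ℤ.- a , ℚ+-cancelʳ (toℚ a) r (toℚ (b ℤ.- a)) (ι-injective _ _ (begin
      ι (r ℚ.+ toℚ a)             ≈⟨ ι-+ r (toℚ a) ⟩
      ι r +ᴹ ι (toℚ a)            ≈⟨ +ᴹ-comm (ι r) _ ⟩
      ι (toℚ a) +ᴹ ι r            ≈⟨ +ᴹ-congʳ u≈a ⟨
      u +ᴹ ι r                    ≈⟨ u+r≈b ⟩
      ι (toℚ b)                   ≈⟨ ι-cong (≡.cong toℚ (ℤ-rightDivides a b)) ⟨
      ι (toℚ (b ℤ.- a ℤ.+ a))     ≈⟨ ι-cong (toℚ-+ (b ℤ.- a) a) ⟩
      ι (toℚ (b ℤ.- a) ℚ.+ toℚ a) ∎))
    where
    open import Algebra.Properties.Group ℚP.+-0-group using () renaming (∙-cancelʳ to ℚ+-cancelʳ)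
    open import Algebra.Properties.Group (CommutativeRing.+-group ℤP.+-*-commutativeRing) using ()
      renaming (//-rightDividesˡ to ℤ-rightDivides)

  double-even⇔int : ∀ v → IsEvenInt (toℚ (+ 2) *ₗ v) ⇔ IsInt v
  double-even⇔int v = mk⇔ halve double
    where
    halve : IsEvenInt (toℚ (+ 2) *ₗ v) → IsInt v
    halve (m , 2v≈2m) = m , (begin
      v                                  ≈⟨ *ₗ-identityˡ v ⟨
      (ℚ.½ ℚ.* toℚ (+ 2)) *ₗ v           ≈⟨ *ₗ-assoc ℚ.½ (toℚ (+ 2)) v ⟩
      ℚ.½ *ₗ (toℚ (+ 2) *ₗ v)            ≈⟨ *ₗ-congˡ 2v≈2m ⟩
      ℚ.½ *ₗ ι (toℚ (+ 2 ℤ.* m))         ≈⟨ ι-* ℚ.½ _ ⟩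
      ι (ℚ.½ ℚ.* toℚ (+ 2 ℤ.* m))        ≈⟨ ι-cong (≡.cong (ℚ.½ ℚ.*_) (toℚ-* (+ 2) m)) ⟩
      ι (ℚ.½ ℚ.* (toℚ (+ 2) ℚ.* toℚ m))  ≈⟨ ι-cong (ℚP.*-assoc ℚ.½ (toℚ (+ 2)) (toℚ m)) ⟨
      ι (ℚ.1ℚ ℚ.* toℚ m)                 ≈⟨ ι-cong (ℚP.*-identityˡ (toℚ m)) ⟩
      ι (toℚ m)                          ∎)
    double : IsInt v → IsEvenInt (toℚ (+ 2) *ₗ v)
    double v-int@(m , _) = m , proj₂ (IsInt-*ₗ (+ 2) v-int)

  dotᴹ-⊛ᵛ : ∀ {n} (N : Mat ℚ n) (v : Vect ℚ n) (z : Vect Carrierᴹ n) →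
    dotᴹ (N ℚM.⊛ᵛ v) z ≈ᴹ ΣM.sum (λ l → v l *ₗ dotᴹ (ℚM.column N l) z)
  dotᴹ-⊛ᵛ N v z = begin
    dotᴹ (N ℚM.⊛ᵛ v) z                              ≈⟨ sumᴹ≈sum (λ i → (N ℚM.⊛ᵛ v) i *ₗ z i) ⟩
    ΣM.sum (λ i → (N ℚM.⊛ᵛ v) i *ₗ z i)             ≈⟨ ΣM.sum-cong (λ i → sum-*ₗ (λ l → N i l ℚ.* v l) (z i)) ⟩
    ΣM.sum (λ i → ΣM.sum (λ l → (N i l ℚ.* v l) *ₗ z i)) ≈⟨ ΣM.∑-comm (λ i l → (N i l ℚ.* v l) *ₗ z i) ⟩
    ΣM.sum (λ l → ΣM.sum (λ i → (N i l ℚ.* v l) *ₗ z i)) ≈⟨ ΣM.sum-cong (λ l → ΣM.sum-cong (λ i → scale-swap (N i l) (v l) (z i))) ⟩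
    ΣM.sum (λ l → ΣM.sum (λ i → v l *ₗ (N i l *ₗ z i))) ≈⟨ ΣM.sum-cong (λ l → *ₗ-sum (v l) (λ i → N i l *ₗ z i)) ⟨
    ΣM.sum (λ l → v l *ₗ ΣM.sum (λ i → N i l *ₗ z i)) ≈⟨ ΣM.sum-cong (λ l → *ₗ-congˡ (sumᴹ≈sum (λ i → N i l *ₗ z i))) ⟨
    ΣM.sum (λ l → v l *ₗ dotᴹ (ℚM.column N l) z)   ∎
    where
    scale-swap : ∀ r s u → (r ℚ.* s) *ₗ u ≈ᴹ s *ₗ (r *ₗ u)
    scale-swap r s u = ≈ᴹ-trans (*ₗ-congʳ (ℚP.*-comm r s)) (*ₗ-assoc s r u)

  dotᴹ-congˡ : ∀ {n} {x y : Vect ℚ n} (z : Vect Carrierᴹ n) → x ℚM.≐ y → dotᴹ x z ≈ᴹ dotᴹ y z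
  dotᴹ-congˡ {x = x} {y} z x≐y = begin
    dotᴹ x z                     ≈⟨ sumᴹ≈sum (λ i → x i *ₗ z i) ⟩
    ΣM.sum (λ i → x i *ₗ z i)    ≈⟨ ΣM.sum-cong (λ i → *ₗ-congʳ (x≐y i)) ⟩
    ΣM.sum (λ i → y i *ₗ z i)    ≈⟨ sumᴹ≈sum (λ i → y i *ₗ z i) ⟨
    dotᴹ y z                     ∎

  sum-unit : ∀ {n} (i : Fin n) (v : Vect Carrierᴹ n) → ΣM.sum (λ l → toℚ (ℤM.𝟙 i l) *ₗ v l) ≈ᴹ v i
  sum-unit i v = ≈ᴹ-trans (ΣM.sum-single (λ l → toℚ (ℤM.𝟙 i l) *ₗ v l) i off-i)
    (≈ᴹ-trans (*ₗ-congʳ (≡.trans (cast-𝟙 i i) (select-≡ i i ℚ.1ℚ ℚ.0ℚ ≡.refl))) (*ₗ-identityˡ (v i)))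
    where
    off-i : ∀ l → l ≢ i → toℚ (ℤM.𝟙 i l) *ₗ v l ≈ᴹ 0ᴹ
    off-i l l≢i = ≈ᴹ-trans (*ₗ-congʳ (≡.trans (cast-𝟙 i l) (select-≢ i l ℚ.1ℚ ℚ.0ℚ (l≢i ∘ ≡.sym))))
      (*ₗ-zeroˡ (v l))

  -- 2 (½ s + v) = s + 2 v, relating f(Be_i) to the diagonal of ᵗBA + 2 diag(ᵗBz).
  double-half : ∀ s v → toℚ (+ 2) *ₗ (ι (ℚ.½ ℚ.* s) +ᴹ v) ≈ᴹ ι s +ᴹ toℚ (+ 2) *ₗ v
  double-half s v = begin
    toℚ (+ 2) *ₗ (ι (ℚ.½ ℚ.* s) +ᴹ v)                 ≈⟨ *ₗ-distribˡ (toℚ (+ 2)) _ v ⟩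
    toℚ (+ 2) *ₗ ι (ℚ.½ ℚ.* s) +ᴹ toℚ (+ 2) *ₗ v      ≈⟨ +ᴹ-congʳ (ι-* (toℚ (+ 2)) _) ⟩
    ι (toℚ (+ 2) ℚ.* (ℚ.½ ℚ.* s)) +ᴹ toℚ (+ 2) *ₗ v   ≈⟨ +ᴹ-congʳ (ι-cong (ℚP.*-assoc (toℚ (+ 2)) ℚ.½ s)) ⟨
    ι (ℚ.1ℚ ℚ.* s) +ᴹ toℚ (+ 2) *ₗ v                  ≈⟨ +ᴹ-congʳ (ι-cong (ℚP.*-identityˡ s)) ⟩
    ι s +ᴹ toℚ (+ 2) *ₗ v                             ∎

  half-dot : ∀ {n} (k d : Vect ℤ n) →
    ι (ℚ.½ ℚ.* toℚ (ℤM.dot k d)) ≈ᴹ ΣM.sum (λ l → toℚ (k l) *ₗ ι (ℚ.½ ℚ.* toℚ (d l)))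
  half-dot k d = begin
    ι (ℚ.½ ℚ.* toℚ (ℤM.dot k d))                              ≈⟨ ι-cong (≡.cong (ℚ.½ ℚ.*_) (toℚ-dot k d)) ⟩
    ι (ℚ.½ ℚ.* ℚM.dot (castVec k) (castVec d))                ≈⟨ ι-cong (ℚM.*-distribˡ-sum ℚ.½ (λ l → toℚ (k l) ℚ.* toℚ (d l))) ⟩
    ι (ℚM.sum (λ l → ℚ.½ ℚ.* (toℚ (k l) ℚ.* toℚ (d l))))      ≈⟨ ι-sum (λ l → ℚ.½ ℚ.* (toℚ (k l) ℚ.* toℚ (d l))) ⟩
    ΣM.sum (λ l → ι (ℚ.½ ℚ.* (toℚ (k l) ℚ.* toℚ (d l))))      ≈⟨ ΣM.sum-cong (λ l → ≈ᴹ-trans (ι-cong (swap ℚ.½ (toℚ (k l)) (toℚ (d l)))) (≈ᴹ-sym (ι-* (toℚ (k l)) _))) ⟩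
    ΣM.sum (λ l → toℚ (k l) *ₗ ι (ℚ.½ ℚ.* toℚ (d l)))         ∎
    where
    swap : ∀ a b c → a ℚ.* (b ℚ.* c) ≡ b ℚ.* (a ℚ.* c)
    swap a b c = ≡.trans (≡.sym (ℚP.*-assoc a b c)) (≡.trans (≡.cong (ℚ._* c) (ℚP.*-comm a b)) (ℚP.*-assoc b a c))

module Lattice {m ℓ : Level} (M : LeftModule ℚP.+-*-ring m ℓ) (e : LeftModule.Carrierᴹ M)
  (e≉0 : ¬ LeftModule._≈ᴹ_ M e (LeftModule.0ᴹ M))
  {n : ℕ} {τ : Mat ℚ n} {A B : Mat ℤ n} (rf : ReducedForm τ A B) (z : Vect (LeftModule.Carrierᴹ M) n) where
  open LeftModule M
  open Coeff M e
  open CoefficientSpace M e e≉0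
  open ReducedFormFacts rf
  open import Relation.Binary.Reasoning.Setoid ≈ᴹ-setoid as ≈ᴹ-Reasoning using ()

  F : Vect ℤ n → Carrierᴹ
  F y = f z τ (castVec y)

  F-cong : ∀ {x y} → x ℤM.≐ y → F x ≈ᴹ F y
  F-cong {x} {y} x≐y = +ᴹ-cong (ι-cong (≡.cong (ℚ.½ ℚ.*_) quadratic≡)) (dotᴹ-congˡ z x̂≐ŷ)
    where
    x̂≐ŷ : castVec x ℚM.≐ castVec y
    x̂≐ŷ i = ≡.cong toℚ (x≐y i)
    quadratic≡ : bilinℚ (castVec x) τ (castVec x) ≡ bilinℚ (castVec y) τ (castVec y)
    quadratic≡ = ≡.trans (bilinℚ≡bilin (castVec x) τ (castVec x))
      (≡.trans (ℚM.dot-cong x̂≐ŷ (ℚM.⊛ᵛ-congʳ τ x̂≐ŷ)) (≡.sym (bilinℚ≡bilin (castVec y) τ (castVec y))))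

  InBZ⇒ : ∀ {y} → InBZ B y → Σ (Vect ℤ n) λ k → y ℤM.≐ B ℤM.⊛ᵛ k
  InBZ⇒ (k , y≡Bk) = k , λ i → ≡.trans (y≡Bk i) (·ℤv≐⊛ᵛ B k i)

  ⇒InBZ : ∀ {y} → Σ (Vect ℤ n) (λ k → y ℤM.≐ B ℤM.⊛ᵛ k) → InBZ B y
  ⇒InBZ (k , y≐Bk) = k , λ i → ≡.trans (y≐Bk i) (≡.sym (·ℤv≐⊛ᵛ B k i))

  -- The test vectors x = 0 and x = e_i in the definition of L extract f(y) and (τy)_i.
  pairing-zero : (v : Vect ℚ n) → bilinℚ (castVec (λ _ → + 0)) τ v ≡ ℚ.0ℚ
  pairing-zero v = ≡.trans (bilinℚ≡bilin (castVec (λ _ → + 0)) τ v)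
    (ℚM.sum-zero (λ i → ℚ.0ℚ ℚ.* (τ ℚM.⊛ᵛ v) i) (λ i → ℚP.*-zeroˡ ((τ ℚM.⊛ᵛ v) i)))

  pairing-unit : (i : Fin n) (v : Vect ℚ n) → bilinℚ (castVec (ℤM.𝟙 i)) τ v ≡ (τ ℚM.⊛ᵛ v) i
  pairing-unit i v = ≡.trans (bilinℚ≡bilin (castVec (ℤM.𝟙 i)) τ v)
    (≡.trans (ℚM.dot-cong {v = τ ℚM.⊛ᵛ v} (cast-𝟙 i) (λ _ → ≡.refl)) (ℚM.dot-unit i (τ ℚM.⊛ᵛ v)))

  -- Part (b), forward: y ∈ L gives f(y) ∈ ℤ and τy ∈ ℤⁿ, hence y ∈ Bℤⁿ by part (a).
  L⇒ : ∀ y → InL z τ y → InBZ B y × IsInt (F y)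
  L⇒ y y∈L = ⇒InBZ (integral⇒Bℤ y c τŷ≐ĉ) , F-int
    where
    F+0≈F : F y +ᴹ ι (bilinℚ (castVec (λ _ → + 0)) τ (castVec y)) ≈ᴹ F y
    F+0≈F = ≈ᴹ-trans (+ᴹ-congˡ (≈ᴹ-trans (ι-cong (pairing-zero (castVec y))) (*ₗ-zeroˡ e))) (+ᴹ-identityʳ (F y))
    F-int : IsInt (F y)
    F-int = IsInt-resp F+0≈F (y∈L (λ _ → + 0))
    τy-int : ∀ i → ∃ λ c → (τ ℚM.⊛ᵛ castVec y) i ≡ toℚ c
    τy-int i = let (c , eq) = IsInt-difference _ F-int (y∈L (ℤM.𝟙 i))
               in c , ≡.trans (≡.sym (pairing-unit i (castVec y))) eq
    c : Vect ℤ n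
    c i = proj₁ (τy-int i)
    τŷ≐ĉ : τ ℚM.⊛ᵛ castVec y ℚM.≐ castVec c
    τŷ≐ĉ i = proj₂ (τy-int i)

  -- Part (b), backward: for y = Bk, ᵗxτy = ᵗx(Ak) is an integer.
  L⇐ : ∀ y → InBZ B y × IsInt (F y) → InL z τ y
  L⇐ y (y∈Bℤ , F-int) x = IsInt-+ F-int (ᵗxAk , ι-cong pairing≡)
    where
    k = proj₁ (InBZ⇒ y∈Bℤ)
    ᵗxAk = ℤM.dot x (A ℤM.⊛ᵛ k)
    τŷ≐Âk : τ ℚM.⊛ᵛ castVec y ℚM.≐ castVec (A ℤM.⊛ᵛ k)
    τŷ≐Âk i = ≡.trans (ℚM.⊛ᵛ-congʳ τ (λ j → ≡.cong toℚ (proj₂ (InBZ⇒ y∈Bℤ) j)) i) (τ-Bk k i)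
    pairing≡ : bilinℚ (castVec x) τ (castVec y) ≡ toℚ ᵗxAk
    pairing≡ = ≡.trans (bilinℚ≡bilin (castVec x) τ (castVec y))
      (≡.trans (ℚM.dot-cong {u = castVec x} (λ _ → ≡.refl) τŷ≐Âk) (≡.sym (toℚ-dot x (A ℤM.⊛ᵛ k))))

  part-b : ∀ y → InL z τ y ⇔ (InBZ B y × IsInt (F y))
  part-b y = mk⇔ (L⇒ y) (L⇐ y)

  -- For part (c): S = ᵗBA and w = ᵗBz, so that f(Bk) = ½ ᵗkSk + ᵗkw.
  S : Mat ℤ n
  S = ℤM.transpose B ℤM.⊛ A

  w : Vect Carrierᴹ n
  w = tBz B z

  -- S = ᵗBτB is symmetric when τ is.
  S-sym : SymMat τ → ∀ i j → S i j ≡ S j i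
  S-sym τ-sym i j = toℚ-injective
    (≡.trans (Ŝ≋ᵗBτB i j) (≡.trans (ℚM.congruence-sym τ (castMat B) τ-sym i j) (≡.sym (Ŝ≋ᵗBτB j i))))
    where
    ᵗBτB : Mat ℚ n
    ᵗBτB = ℚM.transpose (castMat B) ℚM.⊛ (τ ℚM.⊛ castMat B)
    Ŝ≋ᵗBτB : castMat S ℚM.≋ ᵗBτB
    Ŝ≋ᵗBτB i j = ≡.trans (cast-⊛ (ℤM.transpose B) A i j)
      (ℚM.⊛-congʳ (ℚM.transpose (castMat B)) (λ a b → ≡.sym (τB≋A a b)) i j)

  -- On Bℤⁿ: ᵗ(Bk)τ(Bk) = ᵗ(Bk)(Ak) = ᵗk S k, hence f(Bk) = ½ ᵗkSk + ᵗkw.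
  quadratic-on-Bℤ : ∀ k → bilinℚ (castVec (B ℤM.⊛ᵛ k)) τ (castVec (B ℤM.⊛ᵛ k)) ≡ toℚ (ℤM.bilin k S k)
  quadratic-on-Bℤ k = begin
    bilinℚ (castVec (B ℤM.⊛ᵛ k)) τ (castVec (B ℤM.⊛ᵛ k))           ≡⟨ bilinℚ≡bilin (castVec (B ℤM.⊛ᵛ k)) τ (castVec (B ℤM.⊛ᵛ k)) ⟩
    ℚM.dot (castVec (B ℤM.⊛ᵛ k)) (τ ℚM.⊛ᵛ castVec (B ℤM.⊛ᵛ k))     ≡⟨ ℚM.dot-cong {u = castVec (B ℤM.⊛ᵛ k)} (λ _ → ≡.refl) (τ-Bk k) ⟩
    ℚM.dot (castVec (B ℤM.⊛ᵛ k)) (castVec (A ℤM.⊛ᵛ k))             ≡⟨ toℚ-dot (B ℤM.⊛ᵛ k) (A ℤM.⊛ᵛ k) ⟨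
    toℚ (ℤM.dot (B ℤM.⊛ᵛ k) (A ℤM.⊛ᵛ k))                            ≡⟨ ≡.cong toℚ (ℤM.dot-⊛ᵛ B A k k) ⟩
    toℚ (ℤM.bilin k S k)                                             ∎
    where open ≡.≡-Reasoning

  F-on-Bℤ : ∀ k → F (B ℤM.⊛ᵛ k) ≈ᴹ ι (ℚ.½ ℚ.* toℚ (ℤM.bilin k S k)) +ᴹ ΣM.sum (λ l → toℚ (k l) *ₗ w l)
  F-on-Bℤ k = +ᴹ-cong (ι-cong (≡.cong (ℚ.½ ℚ.*_) (quadratic-on-Bℤ k))) (begin
    dotᴹ (castVec (B ℤM.⊛ᵛ k)) z                     ≈⟨ dotᴹ-congˡ z (cast-⊛ᵛ B k) ⟩
    dotᴹ (castMat B ℚM.⊛ᵛ castVec k) z               ≈⟨ dotᴹ-⊛ᵛ (castMat B) (castVec k) z ⟩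
    ΣM.sum (λ l → toℚ (k l) *ₗ w l)                  ∎)
    where open ≈ᴹ-Reasoning

  F-on-unit : ∀ i → F (B ℤM.⊛ᵛ ℤM.𝟙 i) ≈ᴹ ι (ℚ.½ ℚ.* toℚ (S i i)) +ᴹ w i
  F-on-unit i = ≈ᴹ-trans (F-on-Bℤ (ℤM.𝟙 i)) (+ᴹ-cong (ι-cong (≡.cong (λ s → ℚ.½ ℚ.* toℚ s) ᵗeSe≡S)) (sum-unit i w))
    where
    ᵗeSe≡S : ℤM.bilin (ℤM.𝟙 i) S (ℤM.𝟙 i) ≡ S i i
    ᵗeSe≡S = ≡.trans (ℤM.dot-unit i (S ℤM.⊛ᵛ ℤM.𝟙 i)) (≡.trans (ℤM.dot-comm (S i) (ℤM.𝟙 i)) (ℤM.dot-unit i (S i)))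

  key-diagonal : ∀ i → keyMatrix B A z i i ≈ᴹ toℚ (+ 2) *ₗ (ι (ℚ.½ ℚ.* toℚ (S i i)) +ᴹ w i)
  key-diagonal i = ≈ᴹ-sym (≈ᴹ-trans (double-half (toℚ (S i i)) (w i))
    (+ᴹ-cong (ι-cong (≡.cong toℚ (≡.sym (·ℤ≋⊛ (transposeℤ B) A i i))))
             (≈ᴹ-reflexive (≡.sym (select-≡ i i (toℚ (+ 2) *ₗ w i) 0ᴹ ≡.refl)))))

  key-off-diagonal : ∀ i j → i ≢ j → keyMatrix B A z i j ≈ᴹ ι (toℚ (S i j))
  key-off-diagonal i j i≢j = ≈ᴹ-trans (+ᴹ-cong (ι-cong (≡.cong toℚ (·ℤ≋⊛ (transposeℤ B) A i j)))
      (≈ᴹ-reflexive (select-≢ i j (toℚ (+ 2) *ₗ w i) 0ᴹ i≢j)))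
    (+ᴹ-identityʳ _)

  -- If every ½ S_ll + w_l is an integer then f is integral on all of Bℤⁿ, because
  -- ½ ᵗkSk ≡ Σ_l k_l (½ S_ll) modulo ℤ.
  F-integral-on-Bℤ : SymMat τ → (∀ l → IsInt (ι (ℚ.½ ℚ.* toℚ (S l l)) +ᴹ w l)) → ∀ k → IsInt (F (B ℤM.⊛ᵛ k))
  F-integral-on-Bℤ τ-sym half-int k = IsInt-resp (≈ᴹ-sym F≈) (IsInt-+ (X , ≈ᴹ-refl)
    (IsInt-sum _ (λ l → IsInt-*ₗ (k l) (half-int l))))
    where
    parity = quadratic-parity S (S-sym τ-sym) k
    X = proj₁ parity
    Δ = ℤM.dot k (λ l → S l l)
    F≈ : F (B ℤM.⊛ᵛ k) ≈ᴹ ι (toℚ X) +ᴹ ΣM.sum (λ l → toℚ (k l) *ₗ (ι (ℚ.½ ℚ.* toℚ (S l l)) +ᴹ w l))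
    F≈ = begin
      F (B ℤM.⊛ᵛ k)                                                           ≈⟨ F-on-Bℤ k ⟩
      ι (ℚ.½ ℚ.* toℚ (ℤM.bilin k S k)) +ᴹ W                                   ≈⟨ +ᴹ-congʳ (ι-cong (≡.cong (λ s → ℚ.½ ℚ.* toℚ s) (proj₂ parity))) ⟩
      ι (ℚ.½ ℚ.* toℚ (Δ ℤ.+ (X ℤ.+ X))) +ᴹ W                                  ≈⟨ +ᴹ-congʳ (ι-cong (half-even Δ X)) ⟩
      ι (toℚ X ℚ.+ ℚ.½ ℚ.* toℚ Δ) +ᴹ W                                        ≈⟨ +ᴹ-congʳ (ι-+ (toℚ X) _) ⟩
      ι (toℚ X) +ᴹ ι (ℚ.½ ℚ.* toℚ Δ) +ᴹ W                                     ≈⟨ +ᴹ-assoc _ _ W ⟩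
      ι (toℚ X) +ᴹ (ι (ℚ.½ ℚ.* toℚ Δ) +ᴹ W)                                   ≈⟨ +ᴹ-congˡ (+ᴹ-congʳ (half-dot k (λ l → S l l))) ⟩
      ι (toℚ X) +ᴹ (ΣM.sum (λ l → toℚ (k l) *ₗ ι (ℚ.½ ℚ.* toℚ (S l l))) +ᴹ W) ≈⟨ +ᴹ-congˡ (ΣM.∑-distrib-+ (λ l → toℚ (k l) *ₗ ι (ℚ.½ ℚ.* toℚ (S l l))) (λ l → toℚ (k l) *ₗ w l)) ⟨
      ι (toℚ X) +ᴹ ΣM.sum (λ l → toℚ (k l) *ₗ ι (ℚ.½ ℚ.* toℚ (S l l)) +ᴹ toℚ (k l) *ₗ w l)
        ≈⟨ +ᴹ-congˡ (ΣM.sum-cong (λ l → *ₗ-distribˡ (toℚ (k l)) _ (w l))) ⟨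
      ι (toℚ X) +ᴹ ΣM.sum (λ l → toℚ (k l) *ₗ (ι (ℚ.½ ℚ.* toℚ (S l l)) +ᴹ w l)) ∎
      where
      open ≈ᴹ-Reasoning
      W = ΣM.sum (λ l → toℚ (k l) *ₗ w l)

  -- Part (c), forward: if L = Bℤⁿ then f(Be_i) = ½ S_ii + w_i ∈ ℤ, so the diagonal entry
  -- S_ii + 2w_i is even; the off-diagonal entries are the integers S_ij.
  L≡Bℤ⇒even : (∀ y → InL z τ y ⇔ InBZ B y) → EvenIntegral (keyMatrix B A z)
  L≡Bℤ⇒even L≡Bℤ = integral , even
    where
    even : ∀ i → IsEvenInt (keyMatrix B A z i i)
    even i = IsEvenInt-resp (≈ᴹ-sym (key-diagonal i))
      (Equivalence.from (double-even⇔int _) (IsInt-resp (F-on-unit i) (proj₂ (L⇒ (B ℤM.⊛ᵛ ℤM.𝟙 i) Be_i∈L))))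
      where
      Be_i∈L : InL z τ (B ℤM.⊛ᵛ ℤM.𝟙 i)
      Be_i∈L = Equivalence.from (L≡Bℤ (B ℤM.⊛ᵛ ℤM.𝟙 i)) (⇒InBZ (ℤM.𝟙 i , λ _ → ≡.refl))
    integral : ∀ i j → IsInt (keyMatrix B A z i j)
    integral i j = by-cases (i ≟ j)
      where
      by-cases : Dec (i ≡ j) → IsInt (keyMatrix B A z i j)
      by-cases (yes ≡.refl) = let (m , K≈2m) = even i in + 2 ℤ.* m , K≈2m
      by-cases (no i≢j) = S i j , key-off-diagonal i j i≢j

  -- Part (c), backward: evenness of the diagonal makes every ½ S_ll + w_l integral, so f is
  -- integral on Bℤⁿ and part (b) identifies L with Bℤⁿ.
  even⇒L≡Bℤ : SymMat τ → EvenIntegral (keyMatrix B A z) → ∀ y → InL z τ y ⇔ InBZ B y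
  even⇒L≡Bℤ τ-sym (_ , even) y = mk⇔ (proj₁ ∘ L⇒ y) (λ y∈Bℤ → L⇐ y (y∈Bℤ , F-int y∈Bℤ))
    where
    half-int : ∀ l → IsInt (ι (ℚ.½ ℚ.* toℚ (S l l)) +ᴹ w l)
    half-int l = Equivalence.to (double-even⇔int _) (IsEvenInt-resp (key-diagonal l) (even l))
    F-int : InBZ B y → IsInt (F y)
    F-int y∈Bℤ = let (k , y≐Bk) = InBZ⇒ y∈Bℤ
                 in IsInt-resp (≈ᴹ-sym (F-cong y≐Bk)) (F-integral-on-Bℤ τ-sym half-int k)

  part-c : SymMat τ → ((∀ y → InL z τ y ⇔ InBZ B y) ⇔ EvenIntegral (keyMatrix B A z))
  part-c τ-sym = mk⇔ L≡Bℤ⇒even (even⇒L≡Bℤ τ-sym)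

proposition2p9 : ∀ {m ℓ} (M : LeftModule +-*-ring m ℓ) (e : LeftModule.Carrierᴹ M) →
  ¬ (LeftModule._≈ᴹ_ M e (LeftModule.0ᴹ M)) →
  (n : ℕ) (τ : Mat ℚ n) (z : Vect (LeftModule.Carrierᴹ M) n) (A B : Mat ℤ n) →
  SymMat τ → ReducedForm τ A B →
  ((y : Vect ℚ n) → ((IsIntVecℚ y × IsIntVecℚ (τ ·ℚv y)) ⇔ InBZℚ B y))
  × ((y : Vect ℤ n) →
      (Coeff.InL M e z τ y ⇔ (InBZ B y × Coeff.IsInt M e (Coeff.f M e z τ (castVec y)))))
  × (((y : Vect ℤ n) → (Coeff.InL M e z τ y ⇔ InBZ B y))
      ⇔ Coeff.EvenIntegral M e (Coeff.keyMatrix M e B A z))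
proposition2p9 M e e≉0 n τ z A B τ-sym rf =
  ReducedFormFacts.part-a rf , Lattice.part-b M e e≉0 rf z , Lattice.part-c M e e≉0 rf z τ-sym
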